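{- Let $\nu$ be a lattice path from $(0,0)$ to $(s_E,s_N)$ and let $\sigma_\nu$ be the size of the maximal staircase shape $\nu$-Dyck path. Then $\sigma_\nu$ equals the maximum out-degree of an element of the $\nu$-Tamari poset $(\mathcal D_\nu,\le_T)$.
   Context: Let $\nu$ be a lattice path from $(0,0)$ to $(s_E,s_N)$ with unit north ($N$) and east ($E$) steps. A $\nu$-Dyck path is a lattice path from $(0,0)$ to $(s_E,s_N)$ with $N$ and $E$ steps lying weakly above $\nu$; $\mathcal D_\nu$ is the set of them. For $i\in[s_N]$, $r_i^D$ is the point of $D$ immediately before the $i$-th north step. For $p=(x,y)$ on $D$, $\mathrm{horiz}_\nu(p)=X(y)-x$ with $X(y)$ the largest $x$-coordinate of a point of $\nu$ at height $y$. The touch point $t_i^D$ is the first point of $D$ after $r_i^D$ with the same horizontal distance as $r_i^D$. If $r_i^D$ is preceded by an east step, write $D=dEtf$ ($dE$ = subpath from $(0,0)$ to $r_i^D$, $t$ = subpath from $r_i^D$ to $t_i^D$, $f$ = the rest) and set $D\uparrow_i=dtEf$. The $\nu$-Tamari order $\le_T$ is the partial order on $\mathcal D_\nu$ whose cover relations are $D\lessdot_T D\uparrow_i$ whenever defined. The out-degree of $D$ is the number of elements covering $D$ in this poset. A $\nu$-Dyck path is a staircase shape of size $k$ if it equals $N^a(EN)^kE^b$ for some $a,b\ge 0$; the maximal staircase shape $\nu$-Dyck path is the staircase shape $\nu$-Dyck path of largest size, and $\sigma_\nu$ is that size. -}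

module Defs where

open import Data.Nat using (ℕ; zero; suc; _+_; _∸_; _≤_; _<_; _⊔_; _≡ᵇ_)

open import Data.Bool using (Bool; true; false; _∧_; if_then_else_)
open import Data.List using (List; []; _∷_; _++_; length; take; drop; replicate; upTo; map; foldr; mapMaybe; deduplicate; concat)
open import Data.Maybe using (Maybe; just; nothing)
open import Data.Product using (_×_; _,_; proj₁; proj₂; ∃; ∃-syntax)
open import Relation.Binary.PropositionalEquality using (_≡_; refl)
open import Relation.Nullary using (yes; no)
open import Relation.Binary.Definitions using (DecidableEquality)

-- Unit steps: N = (0,1), E = (1,0).  A lattice path from (0,0) is a list of steps.
data Step : Set where
  N E : Step

_≟S_ : DecidableEquality Step
N ≟S N = yes refl
N ≟S E = no (λ ())
E ≟S N = no (λ ())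
E ≟S E = yes refl

_≟P_ : DecidableEquality (List Step)
[] ≟P [] = yes refl
[] ≟P (_ ∷ _) = no (λ ())
(_ ∷ _) ≟P [] = no (λ ())
(a ∷ as) ≟P (b ∷ bs) with a ≟S b | as ≟P bs
... | yes refl | yes refl = yes refl
... | no ne | _ = no (λ { refl → ne refl })
... | yes _ | no ne = no (λ { refl → ne refl })

Path : Set
Path = List Step

#N : Path → ℕ
#N [] = 0
#N (N ∷ p) = suc (#N p)
#N (E ∷ p) = #N p

#E : Path → ℕ
#E [] = 0
#E (E ∷ p) = suc (#E p)
#E (N ∷ p) = #E p

pointAt : Path → ℕ → ℕ × ℕ
pointAt p k = #E (take k p) , #N (take k p)

points : Path → List (ℕ × ℕ)
points p = map (pointAt p) (upTo (suc (length p)))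

-- D lies weakly above ν (same endpoints assumed separately): at every
-- number k of steps, D has made at least as many north steps as ν.
-- (Points after k steps lie on the antidiagonal x + y = k, so this says
--  the lattice point of D on that antidiagonal is weakly above that of ν.)
WeaklyAbove : Path → Path → Set
WeaklyAbove D ν = ∀ k → #N (take k ν) ≤ #N (take k D)

IsνDyck : Path → Path → Set
IsνDyck ν D = (#E D ≡ #E ν) × (#N D ≡ #N ν) × WeaklyAbove D ν

Xν : Path → ℕ → ℕ
Xν ν y = foldr (λ q m → if proj₂ q ≡ᵇ y then proj₁ q ⊔ m else m) 0 (points ν)

-- horizontal distance of a point p = (x , y) (for points on a ν-Dyck path, X(y) ≥ x)
horiz : Path → ℕ × ℕ → ℕ
horiz ν (x , y) = Xν ν y ∸ x

nth : Path → ℕ → Maybe Step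
nth [] _ = nothing
nth (s ∷ p) zero = just s
nth (s ∷ p) (suc k) = nth p k

firstWith : Path → Path → ℕ → List ℕ → Maybe ℕ
firstWith ν D h [] = nothing
firstWith ν D h (j ∷ js) = if horiz ν (pointAt D j) ≡ᵇ h then just j else firstWith ν D h js

-- Rotation at the north step occupying position k (0-based) of D.
-- r = pointAt D k is the point immediately before that north step; it must be
-- preceded by an east step (k ≥ 1, step k-1 is E).  The touch point t is the
-- first point of D after r (index j > k) with the same horizontal distance.
-- With D = dE t f we return D↑ = d t E f.
rotate : Path → Path → ℕ → Maybe Path
rotate ν D zero = nothing
rotate ν D (suc k') with nth D (suc k') | nth D k'
... | just N | just E with firstWith ν D (horiz ν (pointAt D (suc k')))
                             (map (λ i → suc (suc k') + i) (upTo (length D ∸ suc k')))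
...   | just j  = just (take k' D ++ take (j ∸ suc k') (drop (suc k') D) ++ E ∷ drop j D)
...   | nothing = nothing
rotate ν D (suc k') | _ | _ = nothing

-- the elements covering D in the ν-Tamari order: all D↑_i that are defined
covers : Path → Path → List Path
covers ν D = deduplicate _≟P_ (mapMaybe (rotate ν D) (upTo (length D)))

outDegree : Path → Path → ℕ
outDegree ν D = length (covers ν D)

staircase : ℕ → ℕ → ℕ → Path
staircase a k b = replicate a N ++ concat (replicate k (E ∷ N ∷ [])) ++ replicate b E

HasStaircase : Path → ℕ → Set
HasStaircase ν k = ∃[ a ] ∃[ b ] IsνDyck ν (staircase a k b)

IsMaxStaircaseSize : Path → ℕ → Set
IsMaxStaircaseSize ν σ = HasStaircase ν σ × (∀ k → HasStaircase ν k → k ≤ σ)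

IsMaxOutDegree : Path → ℕ → Set
IsMaxOutDegree ν m =
  (∃[ D ] (IsνDyck ν D × outDegree ν D ≡ m)) × (∀ D → IsνDyck ν D → outDegree ν D ≤ m)

-- The out-degree of a ν-Dyck path D is its number of valleys EN.  At a valley the
-- horizontal distance is h; it does not decrease across the north step, drops by at
-- most one per later step and is 0 at the end of D, so it returns to h: every valley
-- has a touch point and a rotation.  Rotations at distinct valleys differ, since the
-- later one keeps the east step of the earlier valley, which the earlier one turns
-- north.  The staircase N^a (EN)^k E^b has k valleys, and a ν-Dyck path with k valleys
-- lies weakly below the staircase of size k with the same endpoints, which is thus a
-- ν-Dyck path too.  So the out-degrees are exactly the sizes of staircase ν-Dyck paths.
module Submission where

open import Defs
open import Data.Nat using (ℕ; zero; suc; _+_; _∸_; _≤_; _<_; _≤′_; ≤′-refl; ≤′-step; _⊔_; _≡ᵇ_; z≤n; s≤s)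
open import Data.Nat.Properties
open import Data.Bool using (Bool; true; false; if_then_else_)
open import Data.Maybe using (Maybe; just; nothing; is-just)
open import Data.List using (List; []; _∷_; _++_; length; take; drop; replicate; map; foldr; upTo; applyUpTo; mapMaybe; deduplicate)
open import Data.List.Properties using (take++drop≡id; length-drop; length-take; take-all; filter-all; ++-identityʳ)
open import Data.List.Relation.Unary.All using (All; []; _∷_)
import Data.List.Relation.Unary.All.Properties as All
open import Data.List.Relation.Unary.AllPairs using ([]; _∷_)
open import Data.List.Relation.Unary.Any using (here; there)
open import Data.List.Relation.Unary.Unique.Propositional using (Unique)
open import Data.List.Relation.Unary.Unique.Propositional.Properties using (upTo⁺)
open import Data.List.Membership.Propositional using (_∈_)
open import Data.List.Membership.Propositional.Properties using (∈-map⁺; ∈-map⁻; ∈-upTo⁺)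
open import Data.Product using (_×_; _,_; proj₁; proj₂; ∃-syntax)
open import Data.Sum using (_⊎_; inj₁; inj₂)
open import Data.Empty using (⊥; ⊥-elim)
open import Function using (_∘_; id)
open import Relation.Binary.Definitions using (DecidableEquality; tri<; tri≈; tri>)
open import Relation.Binary.PropositionalEquality
open import Relation.Nullary using (yes; no; ¬?)

#N-++ : ∀ p q → #N (p ++ q) ≡ #N p + #N q
#N-++ []      q = refl
#N-++ (N ∷ p) q = cong suc (#N-++ p q)
#N-++ (E ∷ p) q = #N-++ p q

#E-++ : ∀ p q → #E (p ++ q) ≡ #E p + #E q
#E-++ []      q = refl
#E-++ (E ∷ p) q = cong suc (#E-++ p q)
#E-++ (N ∷ p) q = #E-++ p q

length≡#E+#N : ∀ p → length p ≡ #E p + #N p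
length≡#E+#N []      = refl
length≡#E+#N (E ∷ p) = cong suc (length≡#E+#N p)
length≡#E+#N (N ∷ p) = trans (cong suc (length≡#E+#N p)) (sym (+-suc (#E p) (#N p)))

#N-take+#N-drop : ∀ m p → #N (take m p) + #N (drop m p) ≡ #N p
#N-take+#N-drop m p = trans (sym (#N-++ (take m p) (drop m p))) (cong #N (take++drop≡id m p))

#E-take+#E-drop : ∀ m p → #E (take m p) + #E (drop m p) ≡ #E p
#E-take+#E-drop m p = trans (sym (#E-++ (take m p) (drop m p))) (cong #E (take++drop≡id m p))

#E-take≤ : ∀ m p → #E (take m p) ≤ #E p
#E-take≤ m p = subst (#E (take m p) ≤_) (#E-take+#E-drop m p) (m≤m+n _ _)

#N-take≤ : ∀ m p → #N (take m p) ≤ #N p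
#N-take≤ m p = subst (#N (take m p) ≤_) (#N-take+#N-drop m p) (m≤m+n _ _)

#E-drop≤ : ∀ m p → #E (drop m p) ≤ #E p
#E-drop≤ m p = subst (#E (drop m p) ≤_) (#E-take+#E-drop m p) (m≤n+m _ _)

#N-drop≤ : ∀ m p → #N (drop m p) ≤ #N p
#N-drop≤ m p = subst (#N (drop m p) ≤_) (#N-take+#N-drop m p) (m≤n+m _ _)

length-drop≡#E+#N : ∀ m p → #E (drop m p) + #N (drop m p) ≡ length p ∸ m
length-drop≡#E+#N m p = trans (sym (length≡#E+#N (drop m p))) (length-drop m p)

#E-take-mono : ∀ {m m′} p → m ≤ m′ → #E (take m p) ≤ #E (take m′ p)
#E-take-mono {zero}           p       _          = z≤n
#E-take-mono {suc m} {suc m′} []      _          = z≤n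
#E-take-mono {suc m} {suc m′} (E ∷ p) (s≤s m≤m′) = s≤s (#E-take-mono p m≤m′)
#E-take-mono {suc m} {suc m′} (N ∷ p) (s≤s m≤m′) = #E-take-mono p m≤m′

#N-take-suc≤ : ∀ j p → #N (take (suc j) p) ≤ suc (#N (take j p))
#N-take-suc≤ j       []      = z≤n
#N-take-suc≤ zero    (N ∷ p) = ≤-refl
#N-take-suc≤ zero    (E ∷ p) = z≤n
#N-take-suc≤ (suc j) (N ∷ p) = s≤s (#N-take-suc≤ j p)
#N-take-suc≤ (suc j) (E ∷ p) = #N-take-suc≤ j p

valleys : Path → ℕ
valleys (E ∷ N ∷ p) = suc (valleys (N ∷ p))
valleys (_ ∷ p)     = valleys p
valleys []          = 0

valleys-E∷ : ∀ p → valleys (E ∷ p) ≤ suc (valleys p)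
valleys-E∷ []      = z≤n
valleys-E∷ (N ∷ p) = ≤-refl
valleys-E∷ (E ∷ p) = n≤1+n _

valleys-++ : ∀ p q → valleys (p ++ q) ≤ #E p + valleys q
valleys-++ []      q = ≤-refl
valleys-++ (N ∷ p) q = valleys-++ p q
valleys-++ (E ∷ p) q = ≤-trans (valleys-E∷ (p ++ q)) (s≤s (valleys-++ p q))

valleys≤#N : ∀ p → valleys p ≤ #N p
valleys≤#N []          = z≤n
valleys≤#N (N ∷ p)     = m≤n⇒m≤1+n (valleys≤#N p)
valleys≤#N (E ∷ [])    = z≤n
valleys≤#N (E ∷ E ∷ p) = valleys≤#N (E ∷ p)
valleys≤#N (E ∷ N ∷ p) = s≤s (valleys≤#N p)

valleys≤#E : ∀ p → valleys p ≤ #E p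
valleys≤#E p = subst₂ (λ r s → valleys r ≤ s) (++-identityʳ p) (+-identityʳ (#E p)) (valleys-++ p [])

#N-replicate-E : ∀ b → #N (replicate b E) ≡ 0
#N-replicate-E zero    = refl
#N-replicate-E (suc b) = #N-replicate-E b

#E-replicate-E : ∀ b → #E (replicate b E) ≡ b
#E-replicate-E zero    = refl
#E-replicate-E (suc b) = cong suc (#E-replicate-E b)

valleys-replicate-E : ∀ b → valleys (replicate b E) ≡ 0
valleys-replicate-E zero          = refl
valleys-replicate-E (suc zero)    = refl
valleys-replicate-E (suc (suc b)) = valleys-replicate-E (suc b)

#N-staircase : ∀ a v b → #N (staircase a v b) ≡ a + v
#N-staircase (suc a) v       b = cong suc (#N-staircase a v b)
#N-staircase zero    (suc v) b = cong suc (#N-staircase zero v b)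
#N-staircase zero    zero    b = #N-replicate-E b

#E-staircase : ∀ a v b → #E (staircase a v b) ≡ v + b
#E-staircase (suc a) v       b = #E-staircase a v b
#E-staircase zero    (suc v) b = cong suc (#E-staircase zero v b)
#E-staircase zero    zero    b = #E-replicate-E b

valleys-staircase : ∀ a v b → valleys (staircase a v b) ≡ v
valleys-staircase (suc a) v       b = valleys-staircase a v b
valleys-staircase zero    (suc v) b = cong suc (valleys-staircase zero v b)
valleys-staircase zero    zero    b = valleys-replicate-E b

staircase₀-suffix : ∀ v b m → let U = drop m (staircase 0 v b) in
                    #N U ≡ 0 ⊎ b + #N U ≤ suc (#E U)
staircase₀-suffix zero b m =
  inj₁ (n≤0⇒n≡0 (subst (#N (drop m (replicate b E)) ≤_) (#N-replicate-E b) (#N-drop≤ m (replicate b E))))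
staircase₀-suffix (suc v) b zero
  rewrite #N-staircase 0 v b | #E-staircase 0 v b = inj₂ (≤-trans (≤-reflexive (+-comm b (suc v))) (n≤1+n _))
staircase₀-suffix (suc v) b (suc zero)
  rewrite #N-staircase 0 v b | #E-staircase 0 v b = inj₂ (≤-reflexive (+-comm b (suc v)))
staircase₀-suffix (suc v) b (suc (suc m)) = staircase₀-suffix v b m

-- The three cases: the suffix starts within E^b, within (EN)^v, or within N^a.
staircase-suffix : ∀ a v b m → let U = drop m (staircase a v b) in
                   #N U ≡ 0 ⊎ b + #N U ≤ suc (#E U) ⊎ b + v ≤ #E U
staircase-suffix zero    v b m with staircase₀-suffix v b m
... | inj₁ noN    = inj₁ noN
... | inj₂ inside = inj₂ (inj₁ inside)
staircase-suffix (suc a) v b zero =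
  inj₂ (inj₂ (≤-reflexive (trans (+-comm b v) (sym (#E-staircase a v b)))))
staircase-suffix (suc a) v b (suc m) = staircase-suffix a v b m

-- If U had more north steps than T, it would have fewer east steps, against every case of staircase-suffix.
staircase-suffix-#N≤ : ∀ a v b m T → let U = drop m (staircase a v b) in
                       #E U + #N U ≡ #E T + #N T → #E T ≤ b + #N T → #E T ≤ b + v → #N U ≤ #N T
staircase-suffix-#N≤ a v b m T |U|≡|T| E≤b+N E≤b+v with #N (drop m (staircase a v b)) ≤? #N T
... | yes ≤N = ≤N
... | no ≰N = ⊥-elim (impossible (staircase-suffix a v b m))
  where
  U = drop m (staircase a v b)
  fewerE : #E U < #E T
  fewerE = +-cancelʳ-< (#N T) (#E U) (#E T)
             (≤-trans (+-monoʳ-< (#E U) (≰⇒> ≰N)) (≤-reflexive |U|≡|T|))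
  impossible : #N U ≡ 0 ⊎ b + #N U ≤ suc (#E U) ⊎ b + v ≤ #E U → ⊥
  impossible (inj₁ noN) = ≰N (subst (_≤ #N T) (sym noN) z≤n)
  impossible (inj₂ (inj₁ inside)) = <-irrefl refl (begin-strict
    b + #N U     ≤⟨ inside ⟩
    suc (#E U)   ≤⟨ fewerE ⟩
    #E T         ≤⟨ E≤b+N ⟩
    b + #N T     <⟨ +-monoʳ-< b (≰⇒> ≰N) ⟩
    b + #N U     ∎)
    where open ≤-Reasoning
  impossible (inj₂ (inj₂ allE)) = <-irrefl refl (≤-<-trans allE (<-≤-trans fewerE E≤b+v))

-- Compare the suffixes after m steps: each valley of D uses an east step of the prefix P or
-- a north step of the suffix T, which bounds #E T as staircase-suffix-#N≤ requires.
staircase-weaklyAbove : ∀ {a v b} D → #N D ≡ a + v → #E D ≡ v + b → v ≤ valleys D →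
                        WeaklyAbove (staircase a v b) D
staircase-weaklyAbove {a} {v} {b} D #N≡ #E≡ v≤ m = +-cancelʳ-≤ (#N T) (#N P) (#N (take m S)) (begin
    #N P + #N T           ≡⟨ #N-take+#N-drop m D ⟩
    #N D                  ≡⟨ trans #N≡ (sym (#N-staircase a v b)) ⟩
    #N S                  ≡⟨ sym (#N-take+#N-drop m S) ⟩
    #N (take m S) + #N U  ≤⟨ +-monoʳ-≤ (#N (take m S)) (staircase-suffix-#N≤ a v b m T |U|≡|T| E≤b+N E≤b+v) ⟩
    #N (take m S) + #N T  ∎)
  where
  open ≤-Reasoning
  S = staircase a v b
  P = take m D
  T = drop m D
  U = drop m S
  |S|≡|D| : length S ≡ length D
  |S|≡|D| = begin-equality
    length S       ≡⟨ length≡#E+#N S ⟩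
    #E S + #N S    ≡⟨ cong₂ _+_ (#E-staircase a v b) (#N-staircase a v b) ⟩
    v + b + (a + v) ≡⟨ sym (cong₂ _+_ #E≡ #N≡) ⟩
    #E D + #N D    ≡⟨ sym (length≡#E+#N D) ⟩
    length D       ∎
  |U|≡|T| : #E U + #N U ≡ #E T + #N T
  |U|≡|T| = begin-equality
    #E U + #N U     ≡⟨ length-drop≡#E+#N m S ⟩
    length S ∸ m    ≡⟨ cong (_∸ m) |S|≡|D| ⟩
    length D ∸ m    ≡⟨ length-drop≡#E+#N m D ⟨
    #E T + #N T     ∎
  v≤#EP+#NT : v ≤ #E P + #N T
  v≤#EP+#NT = begin
    v                  ≤⟨ v≤ ⟩
    valleys D          ≡⟨ cong valleys (take++drop≡id m D) ⟨
    valleys (P ++ T)   ≤⟨ valleys-++ P T ⟩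
    #E P + valleys T   ≤⟨ +-monoʳ-≤ (#E P) (valleys≤#N T) ⟩
    #E P + #N T        ∎
  E≤b+N : #E T ≤ b + #N T
  E≤b+N = +-cancelˡ-≤ (#E P) (#E T) (b + #N T) (begin
    #E P + #E T          ≡⟨ trans (#E-take+#E-drop m D) #E≡ ⟩
    v + b                ≤⟨ +-monoˡ-≤ b v≤#EP+#NT ⟩
    #E P + #N T + b      ≡⟨ +-assoc (#E P) (#N T) b ⟩
    #E P + (#N T + b)    ≡⟨ cong (#E P +_) (+-comm (#N T) b) ⟩
    #E P + (b + #N T)    ∎)
  E≤b+v : #E T ≤ b + v
  E≤b+v = ≤-trans (#E-drop≤ m D) (≤-reflexive (trans #E≡ (+-comm v b)))

hasStaircase-valleys : ∀ {ν D} → IsνDyck ν D → HasStaircase ν (valleys D)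
hasStaircase-valleys {ν} {D} (#E≡ , #N≡ , D-above) =
  a , b , #E-S , #N-S , λ k → ≤-trans (D-above k) (staircase-weaklyAbove D #N-D #E-D ≤-refl k)
  where
  v = valleys D
  a = #N ν ∸ v
  b = #E ν ∸ v
  v≤#N : v ≤ #N ν
  v≤#N = subst (v ≤_) #N≡ (valleys≤#N D)
  v≤#E : v ≤ #E ν
  v≤#E = subst (v ≤_) #E≡ (valleys≤#E D)
  #E-S : #E (staircase a v b) ≡ #E ν
  #E-S = trans (#E-staircase a v b) (m+[n∸m]≡n v≤#E)
  #N-S : #N (staircase a v b) ≡ #N ν
  #N-S = trans (#N-staircase a v b) (m∸n+n≡m v≤#N)
  #N-D : #N D ≡ a + v
  #N-D = trans #N≡ (sym (m∸n+n≡m v≤#N))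
  #E-D : #E D ≡ v + b
  #E-D = trans #E≡ (sym (m+[n∸m]≡n v≤#E))

ivt-up : (f : ℕ → ℕ) → (∀ j → f (suc j) ≤ suc (f j)) →
         ∀ {a b t} → a ≤ b → f a ≤ t → t ≤ f b → ∃[ j ] a ≤ j × j ≤ b × f j ≡ t
ivt-up f step a≤b = go (≤⇒≤′ a≤b)
  where
  go : ∀ {a b t} → a ≤′ b → f a ≤ t → t ≤ f b → ∃[ j ] a ≤ j × j ≤ b × f j ≡ t
  go {a} ≤′-refl fa≤t t≤fa = a , ≤-refl , ≤-refl , ≤-antisym fa≤t t≤fa
  go {t = t} (≤′-step {n = b} a≤′b) fa≤t t≤fsb with t ≤? f b
  ... | yes t≤fb = let j , a≤j , j≤b , fj≡t = go a≤′b fa≤t t≤fb in j , a≤j , m≤n⇒m≤1+n j≤b , fj≡t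
  ... | no t≰fb  = suc b , ≤′⇒≤ (≤′-step a≤′b) , ≤-refl , ≤-antisym (≤-trans (step b) (≰⇒> t≰fb)) t≤fsb

ivt-down : (f : ℕ → ℕ) → (∀ j → f j ≤ suc (f (suc j))) →
           ∀ {a b t} → a ≤ b → t ≤ f a → f b ≤ t → ∃[ j ] a ≤ j × j ≤ b × f j ≡ t
ivt-down f step a≤b = go (≤⇒≤′ a≤b)
  where
  go : ∀ {a b t} → a ≤′ b → t ≤ f a → f b ≤ t → ∃[ j ] a ≤ j × j ≤ b × f j ≡ t
  go {a} ≤′-refl t≤fa fa≤t = a , ≤-refl , ≤-refl , ≤-antisym fa≤t t≤fa
  go {t = t} (≤′-step {n = b} a≤′b) t≤fa fsb≤t with f b ≤? t
  ... | yes fb≤t = let j , a≤j , j≤b , fj≡t = go a≤′b t≤fa fb≤t in j , a≤j , m≤n⇒m≤1+n j≤b , fj≡t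
  ... | no fb≰t  = suc b , ≤′⇒≤ (≤′-step a≤′b) , ≤-refl , ≤-antisym fsb≤t (≤-pred (≤-trans (≰⇒> fb≰t) (step b)))

maxXAtHeight : ℕ → List (ℕ × ℕ) → ℕ
maxXAtHeight y = foldr (λ q m → if proj₂ q ≡ᵇ y then proj₁ q ⊔ m else m) 0

maxXAtHeight-lub : ∀ y {B} qs → All (λ q → proj₂ q ≡ y → proj₁ q ≤ B) qs → maxXAtHeight y qs ≤ B
maxXAtHeight-lub y []       []           = z≤n
maxXAtHeight-lub y (q ∷ qs) (q≤B ∷ qs≤B) with proj₂ q ≡ᵇ y | ≡ᵇ⇒≡ (proj₂ q) y
... | true  | atHeight = ⊔-lub (q≤B (atHeight _)) (maxXAtHeight-lub y qs qs≤B)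
... | false | _        = maxXAtHeight-lub y qs qs≤B

maxXAtHeight-upper : ∀ y {q} qs → q ∈ qs → proj₂ q ≡ y → proj₁ q ≤ maxXAtHeight y qs
maxXAtHeight-upper y (q ∷ qs) (here refl) atHeight with proj₂ q ≡ᵇ y | ≡⇒≡ᵇ (proj₂ q) y atHeight
... | true | _ = m≤m⊔n _ _
maxXAtHeight-upper y (q′ ∷ qs) (there q∈qs) atHeight with proj₂ q′ ≡ᵇ y
... | true  = ≤-trans (maxXAtHeight-upper y qs q∈qs atHeight) (m≤n⊔m _ _)
... | false = maxXAtHeight-upper y qs q∈qs atHeight

Xν-upper : ∀ ν {j} → j ≤ length ν → #E (take j ν) ≤ Xν ν (#N (take j ν))
Xν-upper ν j≤ = maxXAtHeight-upper _ (points ν) (∈-map⁺ (pointAt ν) (∈-upTo⁺ (s≤s j≤))) refl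

Xν-lub : ∀ ν y {B} → (∀ j → j ≤ length ν → #N (take j ν) ≡ y → #E (take j ν) ≤ B) → Xν ν y ≤ B
Xν-lub ν y bound =
  maxXAtHeight-lub y (points ν) (All.map⁺ (All.applyUpTo⁺₁ id _ (λ j< → bound _ (≤-pred j<))))

Xν≤#E : ∀ ν y → Xν ν y ≤ #E ν
Xν≤#E ν y = Xν-lub ν y (λ j _ _ → #E-take≤ j ν)

-- A point of ν at height y is followed by one at height y + 1, which is weakly further east.
Xν-mono : ∀ ν y → suc y ≤ #N ν → Xν ν y ≤ Xν ν (suc y)
Xν-mono ν y y<#N = Xν-lub ν y later
  where
  later : ∀ j → j ≤ length ν → #N (take j ν) ≡ y → #E (take j ν) ≤ Xν ν (suc y)
  later j j≤ atY
    with ivt-up (λ i → #N (take i ν)) (λ i → #N-take-suc≤ i ν) j≤ (≤-trans (≤-reflexive atY) (n≤1+n y))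
                (subst (λ p → suc y ≤ #N p) (sym (take-all (length ν) ν ≤-refl)) y<#N)
  ... | j′ , j≤j′ , j′≤ , atSucY =
    ≤-trans (#E-take-mono ν j≤j′) (subst (λ h → #E (take j′ ν) ≤ Xν ν h) atSucY (Xν-upper ν j′≤))

nth-just⇒< : ∀ p j {s} → nth p j ≡ just s → j < length p
nth-just⇒< (_ ∷ p) zero    _ = s≤s z≤n
nth-just⇒< (_ ∷ p) (suc j) e = s≤s (nth-just⇒< p j e)

nth-take : ∀ p {n i} → i < n → nth (take n p) i ≡ nth p i
nth-take []      {suc n}           _         = refl
nth-take (_ ∷ p) {suc n} {zero}    _         = refl
nth-take (_ ∷ p) {suc n} {suc i}   (s≤s i<n) = nth-take p i<n

nth-drop : ∀ p n → nth (drop n p) 0 ≡ nth p n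
nth-drop []      zero    = refl
nth-drop []      (suc n) = refl
nth-drop (_ ∷ p) zero    = refl
nth-drop (_ ∷ p) (suc n) = nth-drop p n

nth-++ˡ : ∀ p q {i} → i < length p → nth (p ++ q) i ≡ nth p i
nth-++ˡ (_ ∷ p) q {zero}  _         = refl
nth-++ˡ (_ ∷ p) q {suc i} (s≤s i<n) = nth-++ˡ p q i<n

nth-++ʳ : ∀ p q → nth (p ++ q) (length p) ≡ nth q 0
nth-++ʳ []      q = refl
nth-++ʳ (_ ∷ p) q = nth-++ʳ p q

length-take-nth : ∀ p k {s} → nth p k ≡ just s → length (take k p) ≡ k
length-take-nth p k e = trans (length-take k p) (m≤n⇒m⊓n≡m (<⇒≤ (nth-just⇒< p k e)))

take-suc-N : ∀ p j → nth p j ≡ just N →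
             #E (take (suc j) p) ≡ #E (take j p) × #N (take (suc j) p) ≡ suc (#N (take j p))
take-suc-N (N ∷ p) zero    _ = refl , refl
take-suc-N (N ∷ p) (suc j) e = let E≡ , N≡ = take-suc-N p j e in E≡ , cong suc N≡
take-suc-N (E ∷ p) (suc j) e = let E≡ , N≡ = take-suc-N p j e in cong suc E≡ , N≡

take-suc-E : ∀ p j → nth p j ≡ just E →
             #E (take (suc j) p) ≡ suc (#E (take j p)) × #N (take (suc j) p) ≡ #N (take j p)
take-suc-E (E ∷ p) zero    _ = refl , refl
take-suc-E (N ∷ p) (suc j) e = let E≡ , N≡ = take-suc-E p j e in E≡ , cong suc N≡
take-suc-E (E ∷ p) (suc j) e = let E≡ , N≡ = take-suc-E p j e in cong suc E≡ , N≡

take-suc-nothing : ∀ p j → nth p j ≡ nothing → take (suc j) p ≡ take j p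
take-suc-nothing []      zero    _ = refl
take-suc-nothing []      (suc j) _ = refl
take-suc-nothing (s ∷ p) (suc j) e = cong (s ∷_) (take-suc-nothing p j e)

horizAt : Path → Path → ℕ → ℕ
horizAt ν D j = horiz ν (pointAt D j)

horizAt-north : ∀ {ν D} → IsνDyck ν D → ∀ {j} → nth D j ≡ just N → horizAt ν D j ≤ horizAt ν D (suc j)
horizAt-north {ν} {D} (_ , #N≡ , _) {j} N-step with take-suc-N D j N-step
... | E≡ , N≡ rewrite E≡ | N≡ = ∸-monoˡ-≤ (#E (take j D)) (Xν-mono ν _ below-top)
  where
  below-top : suc (#N (take j D)) ≤ #N ν
  below-top = subst₂ _≤_ N≡ #N≡ (#N-take≤ (suc j) D)

∸-suc-≤ : ∀ m n → m ∸ n ≤ suc (m ∸ suc n)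
∸-suc-≤ zero    zero    = z≤n
∸-suc-≤ zero    (suc n) = z≤n
∸-suc-≤ (suc m) zero    = ≤-refl
∸-suc-≤ (suc m) (suc n) = ∸-suc-≤ m n

-- East steps lower the horizontal distance by at most one, north steps do not lower it.
horizAt-step : ∀ {ν D} → IsνDyck ν D → ∀ j → horizAt ν D j ≤ suc (horizAt ν D (suc j))
horizAt-step {ν} {D} dyck j with nth D j in step
... | just N = m≤n⇒m≤1+n (horizAt-north dyck step)
... | just E with take-suc-E D j step
...   | E≡ , N≡ rewrite E≡ | N≡ = ∸-suc-≤ (Xν ν (#N (take j D))) (#E (take j D))
horizAt-step {ν} {D} dyck j | nothing rewrite take-suc-nothing D j step = n≤1+n _

horizAt-end : ∀ {ν D} → IsνDyck ν D → horizAt ν D (length D) ≡ 0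
horizAt-end {ν} {D} (#E≡ , #N≡ , _) rewrite take-all (length D) D ≤-refl | #E≡ | #N≡ =
  m≤n⇒m∸n≡0 (Xν≤#E ν (#N ν))

touchCandidates : Path → ℕ → List ℕ
touchCandidates D k = map (λ i → suc (suc k) + i) (upTo (length D ∸ suc k))

∈-touchCandidates : ∀ D k {j} → suc (suc k) ≤ j → j ≤ length D → j ∈ touchCandidates D k
∈-touchCandidates D k {j} a≤j j≤L =
  subst (_∈ touchCandidates D k) (m+[n∸m]≡n a≤j) (∈-map⁺ (suc (suc k) +_) (∈-upTo⁺ offset<))
  where
  offset< : j ∸ suc (suc k) < length D ∸ suc k
  offset< = ≤-trans (s≤s (∸-monoˡ-≤ (suc (suc k)) j≤L))
                    (≤-reflexive (sym (+-∸-assoc 1 (≤-trans a≤j j≤L))))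

firstWith-is-just : ∀ ν D {h j} js → j ∈ js → horizAt ν D j ≡ h → is-just (firstWith ν D h js) ≡ true
firstWith-is-just ν D {h} (j ∷ js) (here refl) atH with horizAt ν D j ≡ᵇ h | ≡⇒≡ᵇ (horizAt ν D j) h atH
... | true | _ = refl
firstWith-is-just ν D {h} (j′ ∷ js) (there j∈js) atH with horizAt ν D j′ ≡ᵇ h
... | true  = refl
... | false = firstWith-is-just ν D js j∈js atH

firstWith-∈ : ∀ ν D {h j} js → firstWith ν D h js ≡ just j → j ∈ js
firstWith-∈ ν D {h} (j′ ∷ js) found with horizAt ν D j′ ≡ᵇ h
firstWith-∈ ν D     (j′ ∷ js) refl  | true  = here refl
firstWith-∈ ν D     (j′ ∷ js) found | false = there (firstWith-∈ ν D js found)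

touchPoint-exists : ∀ {ν D} → IsνDyck ν D → ∀ k → nth D (suc k) ≡ just N →
                    is-just (firstWith ν D (horizAt ν D (suc k)) (touchCandidates D k)) ≡ true
touchPoint-exists {ν} {D} dyck k N-step
  with ivt-down (horizAt ν D) (horizAt-step dyck) (nth-just⇒< D (suc k) N-step)
                (horizAt-north dyck N-step) (subst (_≤ horizAt ν D (suc k)) (sym (horizAt-end dyck)) z≤n)
... | j , a≤j , j≤L , atH = firstWith-is-just ν D (touchCandidates D k) (∈-touchCandidates D k a≤j j≤L) atH

northAfterEast : Maybe Step → Maybe Step → Bool
northAfterEast (just N) (just E) = true
northAfterEast _        _        = false

-- Indexed, like rotate, by the position of the north step of the valley.
valleyAt : Path → ℕ → Bool
valleyAt D zero    = false
valleyAt D (suc k) = northAfterEast (nth D (suc k)) (nth D k)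

is-just-rotate : ∀ {ν D} → IsνDyck ν D → ∀ k → is-just (rotate ν D k) ≡ valleyAt D k
is-just-rotate dyck zero = refl
is-just-rotate {ν} {D} dyck (suc k) with nth D (suc k) in N-step | nth D k
... | just N | just E with firstWith ν D (horizAt ν D (suc k)) (touchCandidates D k)
                         | touchPoint-exists dyck k N-step
...   | just _  | _ = refl
...   | nothing | ()
is-just-rotate dyck (suc k) | just N  | just N  = refl
is-just-rotate dyck (suc k) | just N  | nothing = refl
is-just-rotate dyck (suc k) | just E  | _       = refl
is-just-rotate dyck (suc k) | nothing | _       = refl

rotate-shape : ∀ ν D k {R} → rotate ν D (suc k) ≡ just R →
               nth D k ≡ just E × nth R k ≡ just N × (∀ {i} → i < k → nth R i ≡ nth D i)
rotate-shape ν D k rotated with nth D (suc k) in N-step | nth D k in E-step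
... | just N | just E with firstWith ν D (horizAt ν D (suc k)) (touchCandidates D k) in found
...   | just j with refl ← rotated = refl , at-k , before-k
  where
  d = take k D
  |d| : length d ≡ k
  |d| = length-take-nth D k E-step
  t = take (j ∸ suc k) (drop (suc k) D)
  t-starts-N : nth (t ++ E ∷ drop j D) 0 ≡ just N
  t-starts-N with ∈-map⁻ (suc (suc k) +_) (firstWith-∈ ν D (touchCandidates D k) found)
  ... | i , _ , j≡ rewrite j≡ | trans (cong (_∸ k) (sym (+-suc k i))) (m+n∸m≡n k (suc i))
    with drop (suc k) D | nth-drop D (suc k)
  ... | _ ∷ _ | head≡ = trans head≡ N-step
  ... | []    | head≡ with () ← trans head≡ N-step
  at-k : nth (d ++ t ++ E ∷ drop j D) k ≡ just N
  at-k = trans (subst (λ n → nth (d ++ t ++ E ∷ drop j D) n ≡ nth (t ++ E ∷ drop j D) 0) |d|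
                      (nth-++ʳ d (t ++ E ∷ drop j D))) t-starts-N
  before-k : ∀ {i} → i < k → nth (d ++ t ++ E ∷ drop j D) i ≡ nth D i
  before-k i<k = trans (nth-++ˡ d _ (subst (_ <_) (sym |d|) i<k)) (nth-take D i<k)
...   | nothing with () ← rotated
rotate-shape ν D k () | just N  | just N
rotate-shape ν D k () | just N  | nothing
rotate-shape ν D k () | just E  | _
rotate-shape ν D k () | nothing | _

rotate-later-differs : ∀ ν D {x y R} → x < y → rotate ν D x ≡ just R → rotate ν D y ≡ just R → ⊥
rotate-later-differs ν D {suc x} {suc y} (s≤s x<y) Rx Ry with rotate-shape ν D x Rx | rotate-shape ν D y Ry
... | D-E , R-N , _ | _ , _ , keeps with () ← trans (sym R-N) (trans (keeps x<y) D-E)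

rotate-injective : ∀ ν D {x y R} → rotate ν D x ≡ just R → rotate ν D y ≡ just R → x ≡ y
rotate-injective ν D {x} {y} Rx Ry with <-cmp x y
... | tri< x<y _ _ = ⊥-elim (rotate-later-differs ν D x<y Rx Ry)
... | tri≈ _ x≡y _ = x≡y
... | tri> _ _ y<x = ⊥-elim (rotate-later-differs ν D y<x Ry Rx)

countUpTo : (ℕ → Bool) → ℕ → ℕ
countUpTo h zero    = 0
countUpTo h (suc n) = if h 0 then suc (countUpTo (h ∘ suc) n) else countUpTo (h ∘ suc) n

countUpTo-cong : ∀ {h h′} → (∀ k → h k ≡ h′ k) → ∀ n → countUpTo h n ≡ countUpTo h′ n
countUpTo-cong h≗h′ zero = refl
countUpTo-cong h≗h′ (suc n) rewrite h≗h′ 0 | countUpTo-cong (h≗h′ ∘ suc) n = refl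

length-mapMaybe-applyUpTo : ∀ {A B : Set} (f : A → Maybe B) (g : ℕ → A) n →
                            length (mapMaybe f (applyUpTo g n)) ≡ countUpTo (is-just ∘ f ∘ g) n
length-mapMaybe-applyUpTo f g zero = refl
length-mapMaybe-applyUpTo f g (suc n) with f (g 0)
... | just _  = cong suc (length-mapMaybe-applyUpTo f (g ∘ suc) n)
... | nothing = length-mapMaybe-applyUpTo f (g ∘ suc) n

countUpTo-valleyAt : ∀ D → countUpTo (valleyAt D) (length D) ≡ valleys D
countUpTo-valleyAt []          = refl
countUpTo-valleyAt (N ∷ [])    = refl
countUpTo-valleyAt (E ∷ [])    = refl
countUpTo-valleyAt (N ∷ N ∷ p) = countUpTo-valleyAt (N ∷ p)
countUpTo-valleyAt (N ∷ E ∷ p) = countUpTo-valleyAt (E ∷ p)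
countUpTo-valleyAt (E ∷ N ∷ p) = cong suc (countUpTo-valleyAt (N ∷ p))
countUpTo-valleyAt (E ∷ E ∷ p) = countUpTo-valleyAt (E ∷ p)

mapMaybe-unique : ∀ {A B : Set} {f : A → Maybe B} → (∀ {x y b} → f x ≡ just b → f y ≡ just b → x ≡ y) →
                  ∀ {xs} → Unique xs → Unique (mapMaybe f xs)
mapMaybe-unique f-inj {[]} [] = []
mapMaybe-unique {f = f} f-inj {x ∷ xs} (x∉xs ∷ uxs) with f x in fx
... | nothing = mapMaybe-unique f-inj uxs
... | just b  = fresh x∉xs ∷ mapMaybe-unique f-inj uxs
  where
  fresh : ∀ {ys} → All (x ≢_) ys → All (b ≢_) (mapMaybe f ys)
  fresh {[]}     []            = []
  fresh {y ∷ ys} (x≢y ∷ x≢ys) with f y in fy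
  ... | nothing = fresh x≢ys
  ... | just c  = (λ { refl → x≢y (f-inj fx fy) }) ∷ fresh x≢ys

deduplicate-unique : ∀ {A : Set} (_≟_ : DecidableEquality A) {xs} → Unique xs → deduplicate _≟_ xs ≡ xs
deduplicate-unique _≟_ {[]}     []           = refl
deduplicate-unique _≟_ {x ∷ xs} (x∉xs ∷ uxs)
  rewrite deduplicate-unique _≟_ uxs = cong (x ∷_) (filter-all (¬? ∘ (x ≟_)) x∉xs)

outDegree≡valleys : ∀ {ν D} → IsνDyck ν D → outDegree ν D ≡ valleys D
outDegree≡valleys {ν} {D} dyck = begin
  outDegree ν D                                    ≡⟨ cong length (deduplicate-unique _≟P_ rotations-unique) ⟩
  length (mapMaybe (rotate ν D) (upTo (length D))) ≡⟨ length-mapMaybe-applyUpTo (rotate ν D) id (length D) ⟩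
  countUpTo (is-just ∘ rotate ν D) (length D)      ≡⟨ countUpTo-cong (is-just-rotate dyck) (length D) ⟩
  countUpTo (valleyAt D) (length D)                ≡⟨ countUpTo-valleyAt D ⟩
  valleys D                                        ∎
  where
  open ≡-Reasoning
  rotations-unique : Unique (mapMaybe (rotate ν D) (upTo (length D)))
  rotations-unique = mapMaybe-unique (rotate-injective ν D) (upTo⁺ (length D))

mainTheorem2 : (ν : Path) (σ : ℕ) → IsMaxStaircaseSize ν σ → IsMaxOutDegree ν σ
mainTheorem2 ν σ ((a , b , staircase-dyck) , maximal) =
  (staircase a σ b , staircase-dyck , trans (outDegree≡valleys staircase-dyck) (valleys-staircase a σ b)) ,
  λ D D-dyck → subst (_≤ σ) (sym (outDegree≡valleys D-dyck)) (maximal (valleys D) (hasStaircase-valleys D-dyck))
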